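{- Let $G$ be a finite simple graph. If $x$ is a construction sequence for $G$ with $\nu(x)=\nu^*(G)$, then $x$ is easy.
   Context: For a finite simple graph $G=(V,E)$ with $p=|V|$, $q=|E|$, $\ell=p+q$, a construction sequence (c-sequence) for $G$ is a bijection $x:\{1,\dots,\ell\}\to V\sqcup E$ such that for every edge $e=uw$, $x^{ -1}(e)>\max\{x^{ -1}(u),x^{ -1}(w)\}$. The cost of an edge $e=uw$ in $x$ is $\nu(e,x)=(x^{ -1}(e)-x^{ -1}(u))+(x^{ -1}(e)-x^{ -1}(w))$, and the cost of $x$ is $\nu(x)=\sum_{e\in E}\nu(e,x)$. The max cost is $\nu^*(G)=\max\nu(x)$ over all c-sequences $x$ for $G$. A c-sequence is easy if no edge precedes a vertex, i.e. every vertex appears before every edge. -}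

module Defs where

open import Data.Nat using (ℕ; zero; suc; _+_; _∸_; _<_; _≤_)
open import Data.Fin using (Fin; toℕ)
open import Data.Sum using (_⊎_; inj₁; inj₂)
open import Data.Product using (_×_; _,_; proj₁; proj₂)
open import Data.List using (List; map) renaming (allFin to allFinL)
open import Data.Nat.ListAction using (sum)
open import Relation.Binary.PropositionalEquality using (_≡_; _≢_)
open import Function.Bundles using (_↔_; Inverse)

record Graph : Set where
  field
    p     : ℕ
    q     : ℕ
    ends  : Fin q → Fin p × Fin p
    loopless : ∀ e → proj₁ (ends e) ≢ proj₂ (ends e)
    simple   : ∀ e f → proj₁ (ends e) ≡ proj₁ (ends f) → proj₂ (ends e) ≡ proj₂ (ends f) → e ≡ f
    simple′  : ∀ e f → proj₁ (ends e) ≡ proj₂ (ends f) → proj₂ (ends e) ≡ proj₁ (ends f) → e ≡ f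

open Graph public

Elem : Graph → Set
Elem G = Fin (p G) ⊎ Fin (q G)

-- A bijection x : {1..ℓ} → V ⊔ E; positions are 0-based (Fin ℓ),
-- which does not affect the costs (only differences of positions occur).
Seq : Graph → Set
Seq G = Fin (p G + q G) ↔ Elem G

pos : (G : Graph) → Seq G → Elem G → ℕ
pos G x a = toℕ (Inverse.from x a)

IsCSeq : (G : Graph) → Seq G → Set
IsCSeq G x = ∀ e → pos G x (inj₁ (proj₁ (ends G e))) < pos G x (inj₂ e)
                 × pos G x (inj₁ (proj₂ (ends G e))) < pos G x (inj₂ e)

-- cost of an edge (truncated subtraction is exact for c-sequences)
edgeCost : (G : Graph) → Seq G → Fin (q G) → ℕ
edgeCost G x e = (pos G x (inj₂ e) ∸ pos G x (inj₁ (proj₁ (ends G e))))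
               + (pos G x (inj₂ e) ∸ pos G x (inj₁ (proj₂ (ends G e))))

cost : (G : Graph) → Seq G → ℕ
cost G x = sum (map (edgeCost G x) (allFinL (q G)))

IsMaxCost : (G : Graph) → Seq G → Set
IsMaxCost G x = ∀ (y : Seq G) → IsCSeq G y → cost G y ≤ cost G x

IsEasy : (G : Graph) → Seq G → Set
IsEasy G x = ∀ v e → pos G x (inj₁ v) < pos G x (inj₂ e)

-- If an edge e precedes a vertex v in a c-sequence x, swapping their positions
-- moves v earlier and e later and leaves everything else in place. Vertices then
-- come no later and edges no earlier, so the result is again a c-sequence and no
-- edge gets cheaper, while e itself gets strictly more expensive (its endpoints
-- still precede it).
module Submission where

open import Defs
open import Data.Nat using (ℕ; _+_; _≤_; _<_)
open import Data.Nat.Properties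
  using (≤-refl; ≤-reflexive; <⇒≤; ≤-<-trans; <-≤-trans; ∸-mono; ∸-monoˡ-<; +-mono-≤; +-mono-<-≤; +-mono-≤-<; <⇒≱)
open import Data.Fin using (Fin; toℕ; _≟_)
open import Data.Fin.Properties using (<-cmp)
open import Data.Fin.Permutation using (transpose)
import Data.Fin.Permutation.Components as PC
open import Data.Sum using (inj₁; inj₂)
open import Data.Product using (_,_; proj₁; proj₂)
open import Data.List using (List; []; _∷_; map) renaming (allFin to allFinL)
open import Data.List.Relation.Unary.Any using (here; there)
open import Data.List.Membership.Propositional using (_∈_)
open import Data.List.Membership.Propositional.Properties using (∈-allFin)
open import Data.Nat.ListAction using (sum)
open import Relation.Binary using (tri<; tri≈; tri>)
open import Relation.Binary.PropositionalEquality using (_≡_; _≢_; refl; sym; trans; cong)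
open import Relation.Nullary using (yes; no; contradiction)
open import Data.Empty using (⊥-elim)
open import Function.Bundles using (_↔_; Inverse)
open import Function.Properties.Inverse using (↔-trans)

sum-map-mono-≤ : ∀ {A : Set} {f g : A → ℕ} (xs : List A) →
                 (∀ a → f a ≤ g a) → sum (map f xs) ≤ sum (map g xs)
sum-map-mono-≤ []       f≤g = ≤-refl
sum-map-mono-≤ (a ∷ xs) f≤g = +-mono-≤ (f≤g a) (sum-map-mono-≤ xs f≤g)

sum-map-mono-< : ∀ {A : Set} {f g : A → ℕ} {a : A} (xs : List A) →
                 (∀ b → f b ≤ g b) → a ∈ xs → f a < g a → sum (map f xs) < sum (map g xs)
sum-map-mono-< (a ∷ xs) f≤g (here refl) fa<ga = +-mono-<-≤ fa<ga (sum-map-mono-≤ xs f≤g)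
sum-map-mono-< (b ∷ xs) f≤g (there a∈xs) fa<ga = +-mono-≤-< (f≤g b) (sum-map-mono-< xs f≤g a∈xs fa<ga)

from-injective : ∀ {A B : Set} (x : A ↔ B) {a b : B} → Inverse.from x a ≡ Inverse.from x b → a ≡ b
from-injective x {a} {b} eq =
  trans (sym (strictlyInverseˡ a)) (trans (cong to eq) (strictlyInverseˡ b))
  where open Inverse x

module _ {n : ℕ} {i j : Fin n} where

  transpose-left : PC.transpose i j i ≡ j
  transpose-left with i ≟ i
  ... | yes _   = refl
  ... | no i≢i = contradiction refl i≢i

  transpose-≤ : ∀ {k} → toℕ i ≤ toℕ j → k ≢ i → toℕ (PC.transpose i j k) ≤ toℕ k
  transpose-≤ {k} i≤j k≢i with k ≟ i
  ... | yes k≡i = contradiction k≡i k≢i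
  ... | no _ with k ≟ j
  ...   | yes refl = i≤j
  ...   | no _     = ≤-refl

  transpose-≥ : ∀ {k} → toℕ i ≤ toℕ j → k ≢ j → toℕ k ≤ toℕ (PC.transpose i j k)
  transpose-≥ {k} i≤j k≢j with k ≟ i
  ... | yes refl = i≤j
  ... | no _ with k ≟ j
  ...   | yes k≡j = contradiction k≡j k≢j
  ...   | no _    = ≤-refl

module _ (G : Graph) where

  record Stretches (x y : Seq G) : Set where
    field
      vertex≤ : ∀ u → pos G y (inj₁ u) ≤ pos G x (inj₁ u)
      edge≥   : ∀ f → pos G x (inj₂ f) ≤ pos G y (inj₂ f)

  module _ {x y : Seq G} (stretch : Stretches x y) where
    open Stretches stretch

    isCSeq-stretch : IsCSeq G x → IsCSeq G y
    isCSeq-stretch cs f = ≤-<-trans (vertex≤ _) (<-≤-trans (proj₁ (cs f)) (edge≥ f))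
                        , ≤-<-trans (vertex≤ _) (<-≤-trans (proj₂ (cs f)) (edge≥ f))

    edgeCost-stretch : ∀ f → edgeCost G x f ≤ edgeCost G y f
    edgeCost-stretch f = +-mono-≤ (∸-mono (edge≥ f) (vertex≤ _)) (∸-mono (edge≥ f) (vertex≤ _))

    edgeCost-stretch-< : IsCSeq G x → ∀ f → pos G x (inj₂ f) < pos G y (inj₂ f) →
                         edgeCost G x f < edgeCost G y f
    edgeCost-stretch-< cs f moved = +-mono-<-≤
      (<-≤-trans (∸-monoˡ-< moved (<⇒≤ (proj₁ (cs f)))) (∸-mono ≤-refl (vertex≤ _)))
      (∸-mono (edge≥ f) (vertex≤ _))

    cost-stretch-< : IsCSeq G x → ∀ f → pos G x (inj₂ f) < pos G y (inj₂ f) → cost G x < cost G y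
    cost-stretch-< cs f moved =
      sum-map-mono-< (allFinL (q G)) edgeCost-stretch (∈-allFin f) (edgeCost-stretch-< cs f moved)

  -- Positions in the result are PC.transpose i j applied to positions in x.
  swapPositions : Seq G → Fin (p G + q G) → Fin (p G + q G) → Seq G
  swapPositions x i j = ↔-trans (transpose j i) x

  module _ (x : Seq G) (v : Fin (p G)) (e : Fin (q G)) where
    open Inverse x using (from)

    swapEdgeVertex : Seq G
    swapEdgeVertex = swapPositions x (from (inj₂ e)) (from (inj₁ v))

    swapEdgeVertex-edge : pos G swapEdgeVertex (inj₂ e) ≡ pos G x (inj₁ v)
    swapEdgeVertex-edge = cong toℕ (transpose-left {i = from (inj₂ e)} {j = from (inj₁ v)})

    swapEdgeVertex-stretches : pos G x (inj₂ e) < pos G x (inj₁ v) → Stretches x swapEdgeVertex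
    swapEdgeVertex-stretches e<v = record
      { vertex≤ = λ u → transpose-≤ (<⇒≤ e<v) (λ eq → contradiction (from-injective x eq) λ ())
      ; edge≥   = λ f → transpose-≥ (<⇒≤ e<v) (λ eq → contradiction (from-injective x eq) λ ())
      }

lemma2 : (G : Graph) (x : Seq G) → IsCSeq G x → IsMaxCost G x → IsEasy G x
lemma2 G x cs maximal v e with <-cmp (Inverse.from x (inj₁ v)) (Inverse.from x (inj₂ e))
... | tri< v<e _ _ = v<e
... | tri≈ _ v≡e _ = contradiction (from-injective x v≡e) λ ()
... | tri> _ _ e<v = ⊥-elim (<⇒≱ costlier (maximal y (isCSeq-stretch G stretched cs)))
  where
  y : Seq G
  y = swapEdgeVertex G x v e

  stretched : Stretches G x y
  stretched = swapEdgeVertex-stretches G x v e e<v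

  costlier : cost G x < cost G y
  costlier = cost-stretch-< G stretched cs e
    (<-≤-trans e<v (≤-reflexive (sym (swapEdgeVertex-edge G x v e))))
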